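{- For every integer $n\ge1$, the set $J(T_n(\{b,y,o,g\}))$ is in bijection with the set of $n\times n$ alternating sign matrices.
   Context: For an integer $n\ge1$, let $T_n$ be the set of triples $(c_1,c_2,c_3)$ of nonnegative integers with $c_1+c_2+c_3\le n-2$. Colors correspond to vectors: green $g=(0,1,0)$, yellow $y=(0,0,1)$, blue $b=(-1,1,0)$, orange $o=(-1,0,1)$. $T_n(\{b,y,o,g\})$ is the poset on $T_n$ whose order relation is the reflexive–transitive closure of the relations $u<u+v$ for all $u,u+v\in T_n$ and $v\in\{b,y,o,g\}$. $J(P)$ is the set of order ideals of a poset $P$. An alternating sign matrix is a square matrix with entries in $\{0,1,-1\}$ in which every row and column sums to $1$ and the nonzero entries of each row and each column alternate in sign. -}

module Defs where

open import Level using (0ℓ)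
open import Data.Bool using (Bool; true)
open import Data.Nat using (ℕ; suc; _+_; _≤_)
open import Data.Integer using (ℤ; -_; 0ℤ; 1ℤ; -1ℤ) renaming (_+_ to _+ℤ_)
open import Data.Integer.Properties using () renaming (_≟_ to _≟ℤ_)
open import Data.Fin using (Fin)
open import Data.List using (List; []; _∷_; foldr; filter; tabulate)
open import Data.Product using (Σ; _×_; _,_; proj₁)
open import Data.Sum using (_⊎_)
open import Data.Unit using (⊤)
open import Relation.Nullary using (¬?)
open import Relation.Binary using (Setoid)
open import Relation.Binary.PropositionalEquality using (_≡_; refl; sym; trans)
open import Relation.Binary.Construct.Closure.ReflexiveTransitive using (Star)

Triple : Set
Triple = ℕ × ℕ × ℕ

-- T n = { (c1,c2,c3) ∈ ℕ³ | c1 + c2 + c3 ≤ n - 2 }  (integer subtraction,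
-- so T 1 is empty; written as c1 + c2 + c3 + 2 ≤ n to avoid truncation)
T : ℕ → Set
T n = Σ Triple (λ { (c₁ , c₂ , c₃) → c₁ + c₂ + c₃ + 2 ≤ n })

data Step : Triple → Triple → Set where
  step-g : ∀ {a b c} → Step (a , b , c) (a , suc b , c)
  step-y : ∀ {a b c} → Step (a , b , c) (a , b , suc c)
  step-b : ∀ {a b c} → Step (suc a , b , c) (a , suc b , c)
  step-o : ∀ {a b c} → Step (suc a , b , c) (a , b , suc c)

_≼_ : ∀ {n} → T n → T n → Set
_≼_ {n} = Star (λ (u w : T n) → Step (proj₁ u) (proj₁ w))

IsOrderIdeal : ∀ n → (T n → Bool) → Set
IsOrderIdeal n I = ∀ (u w : T n) → u ≼ w → I w ≡ true → I u ≡ true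

J-T : ℕ → Set
J-T n = Σ (T n → Bool) (IsOrderIdeal n)

J-T-Setoid : ℕ → Setoid 0ℓ 0ℓ
J-T-Setoid n = record
  { Carrier = J-T n
  ; _≈_ = λ I I' → ∀ u → proj₁ I u ≡ proj₁ I' u
  ; isEquivalence = record
    { refl = λ u → refl
    ; sym = λ p u → sym (p u)
    ; trans = λ p q u → trans (p u) (q u) } }

Matrix : ℕ → Set
Matrix n = Fin n → Fin n → ℤ

sumℤ : List ℤ → ℤ
sumℤ = foldr _+ℤ_ 0ℤ

nonzeros : List ℤ → List ℤ
nonzeros = filter (λ x → ¬? (x ≟ℤ 0ℤ))

Alternates : List ℤ → Set
Alternates [] = ⊤
Alternates (x ∷ []) = ⊤
Alternates (x ∷ y ∷ r) = (y ≡ - x) × Alternates (y ∷ r)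

row : ∀ {n} → Matrix n → Fin n → List ℤ
row A i = tabulate (λ j → A i j)

col : ∀ {n} → Matrix n → Fin n → List ℤ
col A j = tabulate (λ i → A i j)

IsASM : ∀ n → Matrix n → Set
IsASM n A =
  (∀ i j → A i j ≡ 0ℤ ⊎ A i j ≡ 1ℤ ⊎ A i j ≡ -1ℤ) ×
  (∀ i → sumℤ (row A i) ≡ 1ℤ) ×
  (∀ j → sumℤ (col A j) ≡ 1ℤ) ×
  (∀ i → Alternates (nonzeros (row A i))) ×
  (∀ j → Alternates (nonzeros (col A j)))

ASM : ℕ → Set
ASM n = Σ (Matrix n) (IsASM n)

ASM-Setoid : ℕ → Setoid 0ℓ 0ℓ
ASM-Setoid n = record
  { Carrier = ASM n
  ; _≈_ = λ A B → ∀ i j → proj₁ A i j ≡ proj₁ B i j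
  ; isEquivalence = record
    { refl = λ i j → refl
    ; sym = λ p i j → sym (p i j)
    ; trans = λ p q i j → trans (p i j) (q i j) } }

-- An n × n alternating sign matrix A is determined by its corner sums
-- h i j = ∑_{i′ < i, j′ < j} A i′ j′ (0 ≤ i, j ≤ n). Every partial sum of a row or column
-- of an ASM is 0 or 1, so h vanishes on the top and left edges, equals i on the right and j
-- on the bottom edge, and grows by 0 or 1 at each step down or across; conversely every
-- such h is the corner-sum matrix of the matrix of its double differences, which is an ASM.
-- These h correspond to the order ideals of T_n({b,y,o,g}) via
-- (c₁, c₂, c₃) ∈ I ⇔ h (c₁ + c₂ + 1) (c₁ + c₃ + 1) ≤ c₁: the relations g and y translate into
-- the monotonicity of h and the relations b and o into its unit increments. Conversely,
-- membership of (c, x − c, y − c) in an ideal switches from false to true at most once as c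
-- grows, and the number of non-members recovers h (x + 1) (y + 1).

module Submission where

open import Defs
open import Data.Bool using (Bool; true; false)
open import Data.Bool.Properties using (T-≡; ¬-not)
open import Data.Nat using (ℕ; zero; suc; z≤n; s≤s; _≤_; _<_; _≤ᵇ_; _+_; _∸_)
import Data.Nat.Properties as ℕₚ
import Data.Nat.Tactic.RingSolver as ℕ-Solver
open import Data.Integer using (ℤ; +_; -_; _-_; 0ℤ; 1ℤ; -1ℤ; ∣_∣) renaming (_+_ to _+ℤ_)
import Data.Integer.Properties as ℤₚ
open import Data.Integer.Tactic.RingSolver using (solve-∀)
open import Data.Fin using (Fin; toℕ; fromℕ<)
import Data.Fin.Properties as Finₚ
open import Data.List using (List; []; _∷_; tabulate)
import Data.List.Properties as Listₚ
open import Data.Product using (Σ-syntax; _×_; _,_; proj₁; proj₂)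
open import Data.Sum using (_⊎_; inj₁; inj₂)
open import Data.List.Relation.Unary.All using (All; []; _∷_)
import Data.List.Relation.Unary.All.Properties as Allₚ
open import Data.Unit using (⊤; tt)
open import Data.Empty using (⊥-elim)
open import Function using (_∘_)
open import Function.Bundles using (Bijection; Inverse; Equivalence)
open import Function.Properties.Inverse using (Inverse⇒Bijection)
open import Function.Definitions using (Congruent; StrictlyInverseˡ; StrictlyInverseʳ)
open import Relation.Binary.Bundles using (Setoid)
open import Relation.Nullary using (yes; no; ¬_; does)
open import Relation.Nullary.Decidable using (dec-true; dec-false)
open import Relation.Binary.PropositionalEquality
open import Relation.Binary.Construct.Closure.ReflexiveTransitive using (ε; _◅_)

-- Lines of alternating sign matrices

Entry : ℤ → Set
Entry x = x ≡ 0ℤ ⊎ x ≡ 1ℤ ⊎ x ≡ -1ℤ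

val : Bool → ℤ
val false = 0ℤ
val true  = 1ℤ

sign : Bool → ℤ
sign false = 1ℤ
sign true  = -1ℤ

-- The differences of a {0,1}-valued walk from val b to 1.
Increments : Bool → List ℤ → Set
Increments b []      = b ≡ true
Increments b (x ∷ L) = Σ[ b′ ∈ Bool ] x ≡ val b′ - val b × Increments b′ L

AlternatingFrom : ℤ → List ℤ → Set
AlternatingFrom s []      = ⊤
AlternatingFrom s (x ∷ l) = x ≡ s × AlternatingFrom (- s) l

entry-val-diff : ∀ b b′ → Entry (val b′ - val b)
entry-val-diff false false = inj₁ refl
entry-val-diff false true  = inj₂ (inj₁ refl)
entry-val-diff true  false = inj₂ (inj₂ refl)
entry-val-diff true  true  = inj₁ refl

val+diff : ∀ b b′ → val b +ℤ (val b′ - val b) ≡ val b′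
val+diff false false = refl
val+diff false true  = refl
val+diff true  false = refl
val+diff true  true  = refl

alternatingFrom⇒alternates : ∀ s l → AlternatingFrom s l → Alternates l
alternatingFrom⇒alternates s []          _                 = tt
alternatingFrom⇒alternates s (x ∷ [])    _                 = tt
alternatingFrom⇒alternates s (x ∷ y ∷ l) (refl , refl , a) =
  refl , alternatingFrom⇒alternates (- s) (y ∷ l) (refl , a)

alternates⇒alternatingFrom : ∀ x l → Alternates (x ∷ l) → AlternatingFrom x (x ∷ l)
alternates⇒alternatingFrom x []      _          = refl , tt
alternates⇒alternatingFrom x (y ∷ l) (refl , a) = refl , alternates⇒alternatingFrom (- x) l a

sum-alternatingFrom : ∀ s l → AlternatingFrom s l → sumℤ l ≡ 0ℤ ⊎ sumℤ l ≡ s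
sum-alternatingFrom s []      _          = inj₁ refl
sum-alternatingFrom s (x ∷ l) (refl , a) with sum-alternatingFrom (- s) l a
... | inj₁ e = inj₂ (trans (cong (s +ℤ_) e) (ℤₚ.+-identityʳ s))
... | inj₂ e = inj₁ (trans (cong (s +ℤ_) e) (ℤₚ.+-inverseʳ s))

increments⇒sum : ∀ b L → Increments b L → val b +ℤ sumℤ L ≡ 1ℤ
increments⇒sum b []      refl            = refl
increments⇒sum b (x ∷ L) (b′ , refl , r) = begin
  val b +ℤ ((val b′ - val b) +ℤ sumℤ L)  ≡⟨ ℤₚ.+-assoc (val b) _ _ ⟨
  (val b +ℤ (val b′ - val b)) +ℤ sumℤ L  ≡⟨ cong (_+ℤ sumℤ L) (val+diff b b′) ⟩
  val b′ +ℤ sumℤ L                       ≡⟨ increments⇒sum b′ L r ⟩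
  1ℤ                                     ∎
  where open ≡-Reasoning

increments⇒alternatingFrom : ∀ b L → Increments b L → AlternatingFrom (sign b) (nonzeros L)
increments⇒alternatingFrom b     []      _                  = tt
increments⇒alternatingFrom false (x ∷ L) (false , refl , r) = increments⇒alternatingFrom false L r
increments⇒alternatingFrom false (x ∷ L) (true  , refl , r) = refl , increments⇒alternatingFrom true L r
increments⇒alternatingFrom true  (x ∷ L) (false , refl , r) = refl , increments⇒alternatingFrom false L r
increments⇒alternatingFrom true  (x ∷ L) (true  , refl , r) = increments⇒alternatingFrom true L r

increments⇒asmLine : ∀ L → Increments false L → sumℤ L ≡ 1ℤ × Alternates (nonzeros L)
increments⇒asmLine L r =
  trans (sym (ℤₚ.+-identityˡ (sumℤ L))) (increments⇒sum false L r) ,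
  alternatingFrom⇒alternates 1ℤ (nonzeros L) (increments⇒alternatingFrom false L r)

-- The prescribed sign rules out a step up from 1 and a step down from 0.
increments-intro : ∀ b L → All Entry L → AlternatingFrom (sign b) (nonzeros L) →
                   val b +ℤ sumℤ L ≡ 1ℤ → Increments b L
increments-intro false []      _                          _          ()
increments-intro true  []      _                          _          _ = refl
increments-intro b     (x ∷ L) (inj₁ refl ∷ es)           a          s =
  b , val-diff-self b , increments-intro b L es a (trans (cong (val b +ℤ_) (sym (ℤₚ.+-identityˡ _))) s)
  where
  val-diff-self : ∀ b → 0ℤ ≡ val b - val b
  val-diff-self false = refl
  val-diff-self true  = refl
increments-intro false (x ∷ L) (inj₂ (inj₁ refl) ∷ es)   (_ , a)   s =
  true , refl , increments-intro true L es a (trans (sym (ℤₚ.+-identityˡ _)) s)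
increments-intro true  (x ∷ L) (inj₂ (inj₂ refl) ∷ es)   (_ , a)   s =
  false , refl , increments-intro false L es a (trans (ℤₚ.+-assoc 1ℤ -1ℤ (sumℤ L)) s)
increments-intro true  (x ∷ L) (inj₂ (inj₁ refl) ∷ _)    (() , _)  _
increments-intro false (x ∷ L) (inj₂ (inj₂ refl) ∷ _)    (() , _)  _

IsUnit : ℤ → Set
IsUnit x = x ≡ 1ℤ ⊎ x ≡ -1ℤ

nonzeros-isUnit : ∀ L → All Entry L → All IsUnit (nonzeros L)
nonzeros-isUnit []      []                      = []
nonzeros-isUnit (x ∷ L) (inj₁ refl        ∷ es) = nonzeros-isUnit L es
nonzeros-isUnit (x ∷ L) (inj₂ (inj₁ refl) ∷ es) = inj₁ refl ∷ nonzeros-isUnit L es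
nonzeros-isUnit (x ∷ L) (inj₂ (inj₂ refl) ∷ es) = inj₂ refl ∷ nonzeros-isUnit L es

sum-nonzeros : ∀ L → sumℤ (nonzeros L) ≡ sumℤ L
sum-nonzeros []      = refl
sum-nonzeros (x ∷ L) with x ℤₚ.≟ 0ℤ
... | yes refl = trans (sum-nonzeros L) (sym (ℤₚ.+-identityˡ _))
... | no  _    = cong (x +ℤ_) (sum-nonzeros L)

sum≡1⇒alternatingFrom-1 : ∀ l → All IsUnit l → Alternates l → sumℤ l ≡ 1ℤ → AlternatingFrom 1ℤ l
sum≡1⇒alternatingFrom-1 []      _                _ _ = tt
sum≡1⇒alternatingFrom-1 (x ∷ l) (inj₁ refl ∷ _) a _ = alternates⇒alternatingFrom 1ℤ l a
sum≡1⇒alternatingFrom-1 (x ∷ l) (inj₂ refl ∷ _) a s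
  with sum-alternatingFrom -1ℤ (x ∷ l) (alternates⇒alternatingFrom -1ℤ l a)
... | inj₁ e with () ← trans (sym s) e
... | inj₂ e with () ← trans (sym s) e

asmLine⇒increments : ∀ L → All Entry L → sumℤ L ≡ 1ℤ → Alternates (nonzeros L) → Increments false L
asmLine⇒increments L es s a = increments-intro false L es
  (sum≡1⇒alternatingFrom-1 (nonzeros L) (nonzeros-isUnit L es) a (trans (sum-nonzeros L) s))
  (trans (ℤₚ.+-identityˡ (sumℤ L)) s)

prefixSum : (ℕ → ℤ) → ℕ → ℤ
prefixSum f zero    = 0ℤ
prefixSum f (suc j) = prefixSum f j +ℤ f j

prefixSum-suc : ∀ f j → prefixSum f (suc j) ≡ f 0 +ℤ prefixSum (f ∘ suc) j
prefixSum-suc f zero    = trans (ℤₚ.+-identityˡ (f 0)) (sym (ℤₚ.+-identityʳ (f 0)))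
prefixSum-suc f (suc j) = trans (cong (_+ℤ f (suc j)) (prefixSum-suc f j))
                                (ℤₚ.+-assoc (f 0) (prefixSum (f ∘ suc) j) (f (suc j)))

prefixSum-cong : ∀ f g j → (∀ k → k < j → f k ≡ g k) → prefixSum f j ≡ prefixSum g j
prefixSum-cong f g zero    _ = refl
prefixSum-cong f g (suc j) e =
  cong₂ _+ℤ_ (prefixSum-cong f g j (λ k k<j → e k (ℕₚ.m<n⇒m<1+n k<j))) (e j (ℕₚ.n<1+n j))

prefixSum-+ : ∀ f g j → prefixSum (λ k → f k +ℤ g k) j ≡ prefixSum f j +ℤ prefixSum g j
prefixSum-+ f g zero    = refl
prefixSum-+ f g (suc j) = trans (cong (_+ℤ (f j +ℤ g j)) (prefixSum-+ f g j))
                                (interchange (prefixSum f j) (prefixSum g j) (f j) (g j))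
  where
  interchange : ∀ a b c d → (a +ℤ b) +ℤ (c +ℤ d) ≡ (a +ℤ c) +ℤ (b +ℤ d)
  interchange = solve-∀

prefixSum-telescope : ∀ (g : ℕ → ℤ) j → prefixSum (λ k → g (suc k) - g k) j ≡ g j - g 0
prefixSum-telescope g zero    = sym (ℤₚ.+-inverseʳ (g 0))
prefixSum-telescope g (suc j) = trans (cong (_+ℤ (g (suc j) - g j)) (prefixSum-telescope g j))
                                      (collapse (g j) (g 0) (g (suc j)))
  where
  collapse : ∀ a b c → (a - b) +ℤ (c - a) ≡ c - b
  collapse = solve-∀

tabulateℕ : ℕ → (ℕ → ℤ) → List ℤ
tabulateℕ m f = tabulate {n = m} (f ∘ toℕ)

sum-tabulateℕ : ∀ m f → sumℤ (tabulateℕ m f) ≡ prefixSum f m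
sum-tabulateℕ zero    f = refl
sum-tabulateℕ (suc m) f = trans (cong (f 0 +ℤ_) (sum-tabulateℕ m (f ∘ suc))) (sym (prefixSum-suc f m))

states⇒increments : ∀ m f (st : ℕ → Bool) → (∀ j → j < m → f j ≡ val (st (suc j)) - val (st j)) →
                    st m ≡ true → Increments (st 0) (tabulateℕ m f)
states⇒increments zero    f st e stm = stm
states⇒increments (suc m) f st e stm =
  st 1 , e 0 (s≤s z≤n) , states⇒increments m (f ∘ suc) (st ∘ suc) (λ j j<m → e (suc j) (s≤s j<m)) stm

Bit : ℤ → Set
Bit x = x ≡ 0ℤ ⊎ x ≡ 1ℤ

bit-val : ∀ b → Bit (val b)
bit-val false = inj₁ refl
bit-val true  = inj₂ refl

bit-abs : ∀ {x} → Bit x → + ∣ x ∣ ≡ x × ∣ x ∣ ≤ 1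
bit-abs (inj₁ refl) = refl , z≤n
bit-abs (inj₂ refl) = refl , s≤s z≤n

increments-prefixSum : ∀ m f b → Increments b (tabulateℕ m f) →
                       ∀ j → j ≤ m → Σ[ b′ ∈ Bool ] val b +ℤ prefixSum f j ≡ val b′
increments-prefixSum m       f b r zero    _         = b , ℤₚ.+-identityʳ (val b)
increments-prefixSum (suc m) f b (b₁ , e , r) (suc j) (s≤s j≤m)
  with increments-prefixSum m (f ∘ suc) b₁ r j j≤m
... | b′ , e′ = b′ , (begin
  val b +ℤ prefixSum f (suc j)                          ≡⟨ cong (val b +ℤ_) (prefixSum-suc f j) ⟩
  val b +ℤ (f 0 +ℤ prefixSum (f ∘ suc) j)               ≡⟨ ℤₚ.+-assoc (val b) (f 0) _ ⟨
  (val b +ℤ f 0) +ℤ prefixSum (f ∘ suc) j               ≡⟨ cong (λ z → (val b +ℤ z) +ℤ rest) e ⟩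
  (val b +ℤ (val b₁ - val b)) +ℤ prefixSum (f ∘ suc) j  ≡⟨ cong (_+ℤ rest) (val+diff b b₁) ⟩
  val b₁ +ℤ prefixSum (f ∘ suc) j                       ≡⟨ e′ ⟩
  val b′                                                ∎)
  where
  open ≡-Reasoning
  rest : ℤ
  rest = prefixSum (f ∘ suc) j

increments⇒prefixSum-bit : ∀ m f → Increments false (tabulateℕ m f) → ∀ j → j ≤ m → Bit (prefixSum f j)
increments⇒prefixSum-bit m f r j j≤m with increments-prefixSum m f false r j j≤m
... | b′ , e = subst Bit (trans (sym e) (ℤₚ.+-identityˡ (prefixSum f j))) (bit-val b′)

increments⇒total : ∀ m f → Increments false (tabulateℕ m f) → prefixSum f m ≡ 1ℤ
increments⇒total m f r = trans (sym (sum-tabulateℕ m f)) (proj₁ (increments⇒asmLine (tabulateℕ m f) r))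

≤ᵇ-true : ∀ {m n} → m ≤ n → (m ≤ᵇ n) ≡ true
≤ᵇ-true = Equivalence.to T-≡ ∘ ℕₚ.≤⇒≤ᵇ

≤ᵇ-sound : ∀ m n → (m ≤ᵇ n) ≡ true → m ≤ n
≤ᵇ-sound m n = ℕₚ.≤ᵇ⇒≤ m n ∘ Equivalence.from T-≡

≤ᵇ-false : ∀ {m n} → n < m → (m ≤ᵇ n) ≡ false
≤ᵇ-false {m} {n} n<m = ¬-not (λ m≤ᵇn → ℕₚ.<⇒≱ n<m (≤ᵇ-sound m n m≤ᵇn))

Monotone : (ℕ → Bool) → Set
Monotone f = ∀ c → f c ≡ true → f (suc c) ≡ true

isFalse : Bool → ℕ
isFalse true  = 0
isFalse false = 1

falses : (ℕ → Bool) → ℕ → ℕ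
falses f zero    = 0
falses f (suc B) = falses f B + isFalse (f B)

isFalse≤1 : ∀ b → isFalse b ≤ 1
isFalse≤1 true  = z≤n
isFalse≤1 false = s≤s z≤n

falses≤ : ∀ f B → falses f B ≤ B
falses≤ f zero    = z≤n
falses≤ f (suc B) = ℕₚ.≤-trans (ℕₚ.+-mono-≤ (falses≤ f B) (isFalse≤1 (f B)))
                               (ℕₚ.≤-reflexive (ℕₚ.+-comm B 1))

falses-cong : ∀ f g → (∀ c → f c ≡ g c) → ∀ B → falses f B ≡ falses g B
falses-cong f g e zero    = refl
falses-cong f g e (suc B) = cong₂ _+_ (falses-cong f g e B) (cong isFalse (e B))

falses-suc : ∀ f B → falses f (suc B) ≡ isFalse (f 0) + falses (f ∘ suc) B
falses-suc f zero    = ℕₚ.+-comm 0 (isFalse (f 0))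
falses-suc f (suc B) = trans (cong (_+ isFalse (f (suc B))) (falses-suc f B))
                             (ℕₚ.+-assoc (isFalse (f 0)) _ _)

falses-mono : ∀ f B d → falses f B ≤ falses f (d + B)
falses-mono f B zero    = ℕₚ.≤-refl
falses-mono f B (suc d) = ℕₚ.≤-trans (falses-mono f B d) (ℕₚ.m≤m+n _ _)

falses-all : ∀ f B → (∀ c → c < B → f c ≡ false) → falses f B ≡ B
falses-all f zero    _ = refl
falses-all f (suc B) h
  rewrite h B (ℕₚ.n<1+n B) | falses-all f B (λ c c<B → h c (ℕₚ.m<n⇒m<1+n c<B)) = ℕₚ.+-comm B 1

falses-antitone : ∀ f g → (∀ c → g c ≡ true → f c ≡ true) → ∀ B → falses f B ≤ falses g B
falses-antitone f g h zero    = z≤n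
falses-antitone f g h (suc B) = ℕₚ.+-mono-≤ (falses-antitone f g h B) (isFalse-antitone (f B) (g B) (h B))
  where
  isFalse-antitone : ∀ x y → (y ≡ true → x ≡ true) → isFalse x ≤ isFalse y
  isFalse-antitone x false _ = isFalse≤1 x
  isFalse-antitone x true  k rewrite k refl = z≤n

falses-shift : ∀ f g → (∀ c → g c ≡ true → f (suc c) ≡ true) → ∀ B → falses f B ≤ suc (falses g B)
falses-shift f g h B = begin
  falses f B                            ≤⟨ falses-mono f B 1 ⟩
  falses f (suc B)                      ≡⟨ falses-suc f B ⟩
  isFalse (f 0) + falses (f ∘ suc) B    ≤⟨ ℕₚ.+-mono-≤ (isFalse≤1 (f 0)) (falses-antitone (f ∘ suc) g h B) ⟩
  suc (falses g B)                      ∎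
  where open ℕₚ.≤-Reasoning

falses-threshold : ∀ f r B → (∀ c → c < B → f c ≡ (r ≤ᵇ c)) → r ≤ B → falses f B ≡ r
falses-threshold f r zero    h z≤n = refl
falses-threshold f r (suc B) h r≤ with ℕₚ.m≤n⇒m<n∨m≡n r≤
... | inj₂ refl = falses-all f (suc B) (λ c c<B → trans (h c c<B) (≤ᵇ-false c<B))
... | inj₁ (s≤s r≤B)
  rewrite h B (ℕₚ.n<1+n B) | ≤ᵇ-true r≤B
        | falses-threshold f r B (λ c c<B → h c (ℕₚ.m<n⇒m<1+n c<B)) r≤B = ℕₚ.+-identityʳ r

module _ {f : ℕ → Bool} (mono : Monotone f) where

  monotone-≤ : ∀ {c d} → f c ≡ true → c ≤ d → f d ≡ true
  monotone-≤ {c} {d} h c≤d with ℕₚ.m≤n⇒m<n∨m≡n c≤d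
  ... | inj₂ refl = h
  monotone-≤ {c} {suc d} h _ | inj₁ (s≤s c≤d) = mono d (monotone-≤ h c≤d)

  falses≤true : ∀ {c} → f c ≡ true → ∀ B → falses f B ≤ c
  falses≤true h zero    = z≤n
  falses≤true {c} h (suc B) with B ℕₚ.<? c
  ... | yes B<c = ℕₚ.≤-trans (falses≤ f (suc B)) B<c
  ... | no  B≮c rewrite monotone-≤ h (ℕₚ.≮⇒≥ B≮c) =
    ℕₚ.≤-trans (ℕₚ.≤-reflexive (ℕₚ.+-identityʳ _)) (falses≤true h B)

  false<falses : ∀ {c B} → f c ≡ false → c < B → c < falses f B
  false<falses {c} {B} h c<B with ℕₚ.m≤n⇒∃[o]m+o≡n c<B
  ... | d , refl = begin
    suc c              ≡⟨ falses-all f (suc c) below ⟨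
    falses f (suc c)   ≤⟨ falses-mono f (suc c) d ⟩
    falses f (d + suc c) ≡⟨ cong (falses f) (ℕₚ.+-comm d (suc c)) ⟩
    falses f (suc c + d) ∎
    where
    open ℕₚ.≤-Reasoning
    below : ∀ c′ → c′ < suc c → f c′ ≡ false
    below c′ (s≤s c′≤c) with f c′ in eq
    ... | false = refl
    ... | true  = trans (sym (monotone-≤ eq c′≤c)) h

  monotone-threshold : ∀ {c B} → c < B → f c ≡ (falses f B ≤ᵇ c)
  monotone-threshold {c} {B} c<B with f c in eq
  ... | true  = sym (≤ᵇ-true (falses≤true eq B))
  ... | false = sym (≤ᵇ-false (false<falses eq c<B))

-- Corner-sum matrices

UnitStep : ℕ → ℕ → Set
UnitStep a b = a ≤ b × b ≤ suc a

unitStep-+ : ∀ a {b} → b ≤ 1 → UnitStep a (a + b)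
unitStep-+ a b≤1 = ℕₚ.m≤m+n a _ ,
                   ℕₚ.≤-trans (ℕₚ.+-monoʳ-≤ a b≤1) (ℕₚ.≤-reflexive (ℕₚ.+-comm a 1))

[+n]-[+m]≡+[n∸m] : ∀ {a b} → a ≤ b → + b - + a ≡ + (b ∸ a)
[+n]-[+m]≡+[n∸m] {a} {b} a≤b = trans (ℤₚ.[+m]-[+n]≡m⊖n b a) (ℤₚ.⊖-≥ a≤b)

unitStep-diff : ∀ {a b} → UnitStep a b → + b - + a ≡ val (does (a ℕₚ.<? b))
unitStep-diff {a} (a≤b , b≤1+a) with ℕₚ.m≤n⇒m<n∨m≡n b≤1+a
... | inj₂ refl = begin
  + suc a - + a                ≡⟨ [+n]-[+m]≡+[n∸m] a≤b ⟩
  + (suc a ∸ a)                ≡⟨ cong +_ (ℕₚ.m+n∸n≡m 1 a) ⟩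
  1ℤ                           ≡⟨ cong val (dec-true (a ℕₚ.<? suc a) ℕₚ.≤-refl) ⟨
  val (does (a ℕₚ.<? suc a))   ∎
  where open ≡-Reasoning
... | inj₁ (s≤s b≤a) with refl ← ℕₚ.≤-antisym a≤b b≤a = begin
  + a - + a                    ≡⟨ [+n]-[+m]≡+[n∸m] a≤b ⟩
  + (a ∸ a)                    ≡⟨ cong +_ (ℕₚ.n∸n≡0 a) ⟩
  0ℤ                           ≡⟨ cong val (dec-false (a ℕₚ.<? a) (ℕₚ.n≮n a)) ⟨
  val (does (a ℕₚ.<? a))       ∎
  where open ≡-Reasoning

record IsCornerSum (n : ℕ) (h : ℕ → ℕ → ℕ) : Set where
  field
    top    : ∀ j → h 0 j ≡ 0
    left   : ∀ i → h i 0 ≡ 0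
    right  : ∀ i → i ≤ n → h i n ≡ i
    bottom : ∀ j → j ≤ n → h n j ≡ j
    down   : ∀ i j → i < n → j ≤ n → UnitStep (h i j) (h (suc i) j)
    across : ∀ i j → i ≤ n → j < n → UnitStep (h i j) (h i (suc j))

  ≤-row : ∀ i j → i ≤ n → j ≤ n → h i j ≤ i
  ≤-row zero    j _   _   = ℕₚ.≤-reflexive (top j)
  ≤-row (suc i) j i<n j≤n = ℕₚ.≤-trans (proj₂ (down i j i<n j≤n)) (s≤s (≤-row i j (ℕₚ.<⇒≤ i<n) j≤n))

  ≤-col : ∀ i j → i ≤ n → j ≤ n → h i j ≤ j
  ≤-col i zero    _   _   = ℕₚ.≤-reflexive (left i)
  ≤-col i (suc j) i≤n j<n = ℕₚ.≤-trans (proj₂ (across i j i≤n j<n)) (s≤s (≤-col i j i≤n (ℕₚ.<⇒≤ j<n)))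

  private
    ≤-plus-gap : ∀ i → i ≤ n → ∀ d j → j + d ≡ n → i ≤ h i j + d
    ≤-plus-gap i i≤n zero j refl = begin
      i                   ≡⟨ right i i≤n ⟨
      h i (j + 0)         ≡⟨ cong (h i) (ℕₚ.+-identityʳ j) ⟩
      h i j               ≤⟨ ℕₚ.m≤m+n (h i j) 0 ⟩
      h i j + 0           ∎
      where open ℕₚ.≤-Reasoning
    ≤-plus-gap i i≤n (suc d) j e = begin
      i                   ≤⟨ ≤-plus-gap i i≤n d (suc j) (trans (sym (ℕₚ.+-suc j d)) e) ⟩
      h i (suc j) + d     ≤⟨ ℕₚ.+-monoˡ-≤ d (proj₂ (across i j i≤n j<n)) ⟩
      suc (h i j) + d     ≡⟨ ℕₚ.+-suc (h i j) d ⟨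
      h i j + suc d       ∎
      where
      open ℕₚ.≤-Reasoning
      j<n : j < n
      j<n = ℕₚ.≤-trans (s≤s (ℕₚ.m≤m+n j d)) (ℕₚ.≤-reflexive (trans (sym (ℕₚ.+-suc j d)) e))

  +-bound : ∀ i j → i ≤ n → j ≤ n → i + j ≤ h i j + n
  +-bound i j i≤n j≤n with ℕₚ.m≤n⇒∃[o]m+o≡n j≤n
  ... | d , refl = begin
    i + j             ≤⟨ ℕₚ.+-monoˡ-≤ j (≤-plus-gap i i≤n d j refl) ⟩
    h i j + d + j     ≡⟨ ℕₚ.+-assoc (h i j) d j ⟩
    h i j + (d + j)   ≡⟨ cong (_+_ (h i j)) (ℕₚ.+-comm d j) ⟩
    h i j + (j + d)   ∎
    where open ℕₚ.≤-Reasoning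

module Correspondence (n : ℕ) where

  -- Order ideals and corner-sum matrices

  cells<n : ∀ a b c → a + b + c + 2 ≤ n → suc (a + b) < n × suc (a + c) < n
  cells<n a b c p =
    ℕₚ.≤-trans (s≤s (s≤s (ℕₚ.m≤m+n (a + b) c))) (ℕₚ.≤-trans (ℕₚ.≤-reflexive (via-b a b c)) p) ,
    ℕₚ.≤-trans (s≤s (s≤s (ℕₚ.m≤m+n (a + c) b))) (ℕₚ.≤-trans (ℕₚ.≤-reflexive (via-c a b c)) p)
    where
    via-b : ∀ a b c → suc (suc (a + b + c)) ≡ a + b + c + 2
    via-b = ℕ-Solver.solve-∀
    via-c : ∀ a b c → suc (suc (a + c + b)) ≡ a + b + c + 2
    via-c = ℕ-Solver.solve-∀

  cornerIdeal : (ℕ → ℕ → ℕ) → T n → Bool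
  cornerIdeal h ((a , b , c) , _) = h (suc (a + b)) (suc (a + c)) ≤ᵇ a

  module _ {h : ℕ → ℕ → ℕ} (isCornerSum : IsCornerSum n h) where
    open IsCornerSum isCornerSum

    cornerIdeal-step : ∀ (u w : T n) → Step (proj₁ u) (proj₁ w) →
                       cornerIdeal h w ≡ true → cornerIdeal h u ≡ true
    cornerIdeal-step ((a , b , c) , p) _ step-g hw = ≤ᵇ-true (begin
      h (suc (a + b)) (suc (a + c))        ≤⟨ proj₁ (down _ _ X<n (ℕₚ.<⇒≤ Y<n)) ⟩
      h (suc (suc (a + b))) (suc (a + c))  ≡⟨ cong (λ z → h (suc z) (suc (a + c))) (ℕₚ.+-suc a b) ⟨
      h (suc (a + suc b)) (suc (a + c))    ≤⟨ ≤ᵇ-sound _ _ hw ⟩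
      a                                    ∎)
      where
      open ℕₚ.≤-Reasoning
      X<n : suc (a + b) < n
      X<n = proj₁ (cells<n a b c p)
      Y<n : suc (a + c) < n
      Y<n = proj₂ (cells<n a b c p)
    cornerIdeal-step ((a , b , c) , p) _ step-y hw = ≤ᵇ-true (begin
      h (suc (a + b)) (suc (a + c))        ≤⟨ proj₁ (across _ _ (ℕₚ.<⇒≤ X<n) Y<n) ⟩
      h (suc (a + b)) (suc (suc (a + c)))  ≡⟨ cong (λ z → h (suc (a + b)) (suc z)) (ℕₚ.+-suc a c) ⟨
      h (suc (a + b)) (suc (a + suc c))    ≤⟨ ≤ᵇ-sound _ _ hw ⟩
      a                                    ∎)
      where
      open ℕₚ.≤-Reasoning
      X<n : suc (a + b) < n
      X<n = proj₁ (cells<n a b c p)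
      Y<n : suc (a + c) < n
      Y<n = proj₂ (cells<n a b c p)
    cornerIdeal-step ((suc a , b , c) , p) ((_ , _ , _) , q) step-b hw = ≤ᵇ-true (begin
      h (suc (suc (a + b))) (suc (suc (a + c)))   ≤⟨ proj₂ (across _ _ (ℕₚ.<⇒≤ X<n) Y<n) ⟩
      suc (h (suc (suc (a + b))) (suc (a + c)))   ≡⟨ cong (λ z → suc (h (suc z) (suc (a + c)))) (ℕₚ.+-suc a b) ⟨
      suc (h (suc (a + suc b)) (suc (a + c)))     ≤⟨ s≤s (≤ᵇ-sound _ _ hw) ⟩
      suc a                                       ∎)
      where
      open ℕₚ.≤-Reasoning
      X<n : suc (suc (a + b)) < n
      X<n = proj₁ (cells<n (suc a) b c p)
      Y<n : suc (a + c) < n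
      Y<n = proj₂ (cells<n a (suc b) c q)
    cornerIdeal-step ((suc a , b , c) , p) ((_ , _ , _) , q) step-o hw = ≤ᵇ-true (begin
      h (suc (suc (a + b))) (suc (suc (a + c)))   ≤⟨ proj₂ (down _ _ X<n (ℕₚ.<⇒≤ Y<n)) ⟩
      suc (h (suc (a + b)) (suc (suc (a + c))))   ≡⟨ cong (λ z → suc (h (suc (a + b)) (suc z))) (ℕₚ.+-suc a c) ⟨
      suc (h (suc (a + b)) (suc (a + suc c)))     ≤⟨ s≤s (≤ᵇ-sound _ _ hw) ⟩
      suc a                                       ∎)
      where
      open ℕₚ.≤-Reasoning
      X<n : suc (a + b) < n
      X<n = proj₁ (cells<n a b (suc c) q)
      Y<n : suc (suc (a + c)) < n
      Y<n = proj₂ (cells<n (suc a) b c p)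

    cornerIdeal-isOrderIdeal : IsOrderIdeal n (cornerIdeal h)
    cornerIdeal-isOrderIdeal u w ε         hw = hw
    cornerIdeal-isOrderIdeal u w (_◅_ {j = v} s v≼w) hw =
      cornerIdeal-step u v s (cornerIdeal-isOrderIdeal v w v≼w hw)

  extend : (T n → Bool) → Triple → Bool
  extend I (a , b , c) with a + b + c + 2 ℕₚ.≤? n
  ... | yes p = I ((a , b , c) , p)
  ... | no  _ = false

  extend-≡ : ∀ I a b c (p : a + b + c + 2 ≤ n) → extend I (a , b , c) ≡ I ((a , b , c) , p)
  extend-≡ I a b c p with a + b + c + 2 ℕₚ.≤? n
  ... | yes p′ = cong (λ q → I ((a , b , c) , q)) (ℕₚ.≤-irrelevant p′ p)
  ... | no ¬p  = ⊥-elim (¬p p)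

  extend-true : ∀ I a b c → extend I (a , b , c) ≡ true → a + b + c + 2 ≤ n
  extend-true I a b c h with a + b + c + 2 ℕₚ.≤? n
  ... | yes p = p

  extend-outside : ∀ I a b c → ¬ (a + b + c + 2 ≤ n) → extend I (a , b , c) ≡ false
  extend-outside I a b c ¬p with a + b + c + 2 ℕₚ.≤? n
  ... | yes p = ⊥-elim (¬p p)
  ... | no  _ = refl

  cells<weight : ∀ c p q → suc (c + p) < c + p + q + 2 × suc (c + q) < c + p + q + 2
  cells<weight c p q = ℕₚ.≤-trans (ℕₚ.m≤m+n _ q) (ℕₚ.≤-reflexive (via-p c p q)) ,
                       ℕₚ.≤-trans (ℕₚ.m≤m+n _ p) (ℕₚ.≤-reflexive (via-q c p q))
    where
    via-p : ∀ c p q → suc (suc (c + p)) + q ≡ c + p + q + 2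
    via-p = ℕ-Solver.solve-∀
    via-q : ∀ c p q → suc (suc (c + q)) + p ≡ c + p + q + 2
    via-q = ℕ-Solver.solve-∀

  extend-beyond : ∀ I c p q → n ≤ suc (c + p) ⊎ n ≤ suc (c + q) → extend I (c , p , q) ≡ false
  extend-beyond I c p q (inj₁ n≤) = extend-outside I c p q λ w →
    ℕₚ.n≮n _ (ℕₚ.<-≤-trans (proj₁ (cells<weight c p q)) (ℕₚ.≤-trans w n≤))
  extend-beyond I c p q (inj₂ n≤) = extend-outside I c p q λ w →
    ℕₚ.n≮n _ (ℕₚ.<-≤-trans (proj₂ (cells<weight c p q)) (ℕₚ.≤-trans w n≤))

  extend-cong : ∀ I I′ → (∀ u → I u ≡ I′ u) → ∀ u → extend I u ≡ extend I′ u
  extend-cong I I′ e (a , b , c) with a + b + c + 2 ℕₚ.≤? n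
  ... | yes p = e _
  ... | no  _ = refl

  step-weight : ∀ {a b c a′ b′ c′} → Step (a , b , c) (a′ , b′ , c′) → a + b + c + 2 ≤ a′ + b′ + c′ + 2
  step-weight {a} {b} {c} step-g = ℕₚ.≤-trans (ℕₚ.n≤1+n _) (ℕₚ.≤-reflexive (suc-b a b c))
    where suc-b : ∀ a b c → suc (a + b + c + 2) ≡ a + suc b + c + 2
          suc-b = ℕ-Solver.solve-∀
  step-weight {a} {b} {c} step-y = ℕₚ.≤-trans (ℕₚ.n≤1+n _) (ℕₚ.≤-reflexive (suc-c a b c))
    where suc-c : ∀ a b c → suc (a + b + c + 2) ≡ a + b + suc c + 2
          suc-c = ℕ-Solver.solve-∀
  step-weight {b = b} {c} {a′} step-b = ℕₚ.≤-reflexive (move-b a′ b c)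
    where move-b : ∀ a b c → suc a + b + c + 2 ≡ a + suc b + c + 2
          move-b = ℕ-Solver.solve-∀
  step-weight {b = b} {c} {a′} step-o = ℕₚ.≤-reflexive (move-c a′ b c)
    where move-c : ∀ a b c → suc a + b + c + 2 ≡ a + b + suc c + 2
          move-c = ℕ-Solver.solve-∀

  extend-downward : ∀ {I} → IsOrderIdeal n I → ∀ {a b c a′ b′ c′} → Step (a , b , c) (a′ , b′ , c′) →
                    extend I (a′ , b′ , c′) ≡ true → extend I (a , b , c) ≡ true
  extend-downward {I} isI {a} {b} {c} {a′} {b′} {c′} s hw =
    trans (extend-≡ I a b c p)
          (isI ((a , b , c) , p) ((a′ , b′ , c′) , q) (s ◅ ε) (trans (sym (extend-≡ I a′ b′ c′ q)) hw))
    where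
    q : a′ + b′ + c′ + 2 ≤ n
    q = extend-true I a′ b′ c′ hw
    p : a + b + c + 2 ≤ n
    p = ℕₚ.≤-trans (step-weight s) q

  -- column I k x y c is the membership of (k + c , x ∸ c , y ∸ c), and true once c exceeds x or y.
  column : (T n → Bool) → ℕ → ℕ → ℕ → ℕ → Bool
  column I k x       y       zero    = extend I (k , x , y)
  column I k zero    y       (suc c) = true
  column I k (suc x) zero    (suc c) = true
  column I k (suc x) (suc y) (suc c) = column I (suc k) x y c

  column-cong : ∀ I I′ → (∀ u → I u ≡ I′ u) → ∀ k x y c → column I k x y c ≡ column I′ k x y c
  column-cong I I′ e k x       y       zero    = extend-cong I I′ e (k , x , y)
  column-cong I I′ e k zero    y       (suc c) = refl
  column-cong I I′ e k (suc x) zero    (suc c) = refl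
  column-cong I I′ e k (suc x) (suc y) (suc c) = column-cong I I′ e (suc k) x y c

  column-beyond : ∀ I k x y c → x < c ⊎ y < c → column I k x y c ≡ true
  column-beyond I k x       y       zero    (inj₁ ())
  column-beyond I k x       y       zero    (inj₂ ())
  column-beyond I k zero    y       (suc c) _              = refl
  column-beyond I k (suc x) zero    (suc c) _              = refl
  column-beyond I k (suc x) (suc y) (suc c) (inj₁ (s≤s l)) = column-beyond I (suc k) x y c (inj₁ l)
  column-beyond I k (suc x) (suc y) (suc c) (inj₂ (s≤s l)) = column-beyond I (suc k) x y c (inj₂ l)

  column-diagonal : ∀ I k c p q → column I k (c + p) (c + q) c ≡ extend I (k + c , p , q)
  column-diagonal I k zero    p q = cong (λ z → extend I (z , p , q)) (sym (ℕₚ.+-identityʳ k))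
  column-diagonal I k (suc c) p q =
    trans (column-diagonal I (suc k) c p q) (cong (λ z → extend I (z , p , q)) (sym (ℕₚ.+-suc k c)))

  module _ {I : T n → Bool} (isI : IsOrderIdeal n I) where

    column-monotone : ∀ k x y → Monotone (column I k x y)
    column-monotone k zero    y       zero    h = refl
    column-monotone k (suc x) zero    zero    h = refl
    column-monotone k (suc x) (suc y) zero    h =
      extend-downward isI (step-b {k} {x} {y}) (extend-downward isI (step-y {k} {suc x} {y}) h)
    column-monotone k zero    y       (suc c) h = refl
    column-monotone k (suc x) zero    (suc c) h = refl
    column-monotone k (suc x) (suc y) (suc c) h = column-monotone (suc k) x y c h

    column-downˣ : ∀ k x y c → column I k (suc x) y c ≡ true → column I k x y c ≡ true
    column-downˣ k x       y       zero    h = extend-downward isI (step-g {k} {x} {y}) h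
    column-downˣ k zero    y       (suc c) h = refl
    column-downˣ k (suc x) zero    (suc c) h = refl
    column-downˣ k (suc x) (suc y) (suc c) h = column-downˣ (suc k) x y c h

    column-downʸ : ∀ k x y c → column I k x (suc y) c ≡ true → column I k x y c ≡ true
    column-downʸ k x       y       zero    h = extend-downward isI (step-y {k} {x} {y}) h
    column-downʸ k zero    y       (suc c) h = refl
    column-downʸ k (suc x) zero    (suc c) h = refl
    column-downʸ k (suc x) (suc y) (suc c) h = column-downʸ (suc k) x y c h

    column-shiftˣ : ∀ k x y c → column I k x y c ≡ true → column I k (suc x) y (suc c) ≡ true
    column-shiftˣ k x       zero    zero    h = refl
    column-shiftˣ k x       (suc y) zero    h = extend-downward isI (step-o {k} {x} {y}) h
    column-shiftˣ k zero    zero    (suc c) h = refl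
    column-shiftˣ k zero    (suc y) (suc c) h = refl
    column-shiftˣ k (suc x) zero    (suc c) h = refl
    column-shiftˣ k (suc x) (suc y) (suc c) h = column-shiftˣ (suc k) x y c h

    column-shiftʸ : ∀ k x y c → column I k x y c ≡ true → column I k x (suc y) (suc c) ≡ true
    column-shiftʸ k zero    y       zero    h = refl
    column-shiftʸ k (suc x) y       zero    h = extend-downward isI (step-b {k} {x} {y}) h
    column-shiftʸ k zero    y       (suc c) h = refl
    column-shiftʸ k (suc zero)    zero    (suc c) h = refl
    column-shiftʸ k (suc (suc x)) zero    (suc c) h = refl
    column-shiftʸ k (suc x) (suc y) (suc c) h = column-shiftʸ (suc k) x y c h

  column-threshold : ∀ I x y r → r ≤ suc x → r ≤ suc y →
                     (∀ c p q → c + p ≡ x → c + q ≡ y → extend I (c , p , q) ≡ (r ≤ᵇ c)) →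
                     ∀ c → column I 0 x y c ≡ (r ≤ᵇ c)
  column-threshold I x y r r≤x r≤y diagonal c with c ℕₚ.≤? x | c ℕₚ.≤? y
  ... | no c≰x | _ = trans (column-beyond I 0 x y c (inj₁ (ℕₚ.≰⇒> c≰x)))
                           (sym (≤ᵇ-true (ℕₚ.≤-trans r≤x (ℕₚ.≰⇒> c≰x))))
  ... | yes _ | no c≰y = trans (column-beyond I 0 x y c (inj₂ (ℕₚ.≰⇒> c≰y)))
                               (sym (≤ᵇ-true (ℕₚ.≤-trans r≤y (ℕₚ.≰⇒> c≰y))))
  ... | yes c≤x | yes c≤y with ℕₚ.m≤n⇒∃[o]m+o≡n c≤x | ℕₚ.m≤n⇒∃[o]m+o≡n c≤y
  ... | p , refl | q , refl = trans (column-diagonal I 0 c p q) (diagonal c p q refl refl)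

  idealCorner : (T n → Bool) → ℕ → ℕ → ℕ
  idealCorner I zero    _       = 0
  idealCorner I (suc i) zero    = 0
  idealCorner I (suc x) (suc y) = falses (column I 0 x y) n

  idealCorner-cong : ∀ I I′ → (∀ u → I u ≡ I′ u) → ∀ i j → idealCorner I i j ≡ idealCorner I′ i j
  idealCorner-cong I I′ e zero    j       = refl
  idealCorner-cong I I′ e (suc i) zero    = refl
  idealCorner-cong I I′ e (suc x) (suc y) = falses-cong _ _ (column-cong I I′ e 0 x y) n

  idealCorner-threshold : ∀ I x y r → r ≤ n → r ≤ suc x → r ≤ suc y →
                          (∀ c p q → c + p ≡ x → c + q ≡ y → extend I (c , p , q) ≡ (r ≤ᵇ c)) →
                          idealCorner I (suc x) (suc y) ≡ r
  idealCorner-threshold I x y r r≤n r≤x r≤y diagonal =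
    falses-threshold _ r n (λ c _ → column-threshold I x y r r≤x r≤y diagonal c) r≤n

  module _ {I : T n → Bool} (isI : IsOrderIdeal n I) where

    idealCorner-down : ∀ i j → UnitStep (idealCorner I i j) (idealCorner I (suc i) j)
    idealCorner-down zero    zero    = z≤n , z≤n
    idealCorner-down zero    (suc y) = z≤n , falses≤true (column-monotone isI 0 0 y) {1} refl n
    idealCorner-down (suc x) zero    = z≤n , z≤n
    idealCorner-down (suc x) (suc y) = falses-antitone _ _ (column-downˣ isI 0 x y) n ,
                                       falses-shift _ _ (column-shiftˣ isI 0 x y) n

    idealCorner-across : ∀ i j → UnitStep (idealCorner I i j) (idealCorner I i (suc j))
    idealCorner-across zero    j       = z≤n , z≤n
    idealCorner-across (suc x) zero    = z≤n , falses≤true (column-monotone isI 0 x 0) {1} (edge x) n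
      where
      edge : ∀ x → column I 0 x 0 1 ≡ true
      edge zero    = refl
      edge (suc x) = refl
    idealCorner-across (suc x) (suc y) = falses-antitone _ _ (column-downʸ isI 0 x y) n ,
                                         falses-shift _ _ (column-shiftʸ isI 0 x y) n

    idealCorner-isCornerSum : IsCornerSum n (idealCorner I)
    idealCorner-isCornerSum = record
      { top    = λ _ → refl
      ; left   = left
      ; right  = right
      ; bottom = bottom
      ; down   = λ i j _ _ → idealCorner-down i j
      ; across = λ i j _ _ → idealCorner-across i j
      }
      where
      left : ∀ i → idealCorner I i 0 ≡ 0
      left zero    = refl
      left (suc i) = refl
      right : ∀ i → i ≤ n → idealCorner I i n ≡ i
      right zero    _ = refl
      right (suc x) x<n@(s≤s {n = m} _) = idealCorner-threshold I x m (suc x) x<n ℕₚ.≤-refl x<n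
        λ c p q c+p≡x c+q≡m → trans (extend-beyond I c p q (inj₂ (ℕₚ.≤-reflexive (cong suc (sym c+q≡m)))))
                                    (sym (≤ᵇ-false (s≤s (subst (c ≤_) c+p≡x (ℕₚ.m≤m+n c p)))))
      bottom : ∀ j → j ≤ n → idealCorner I n j ≡ j
      bottom zero    _ = left n
      bottom (suc y) y<n@(s≤s {n = m} _) = idealCorner-threshold I m y (suc y) y<n y<n ℕₚ.≤-refl
        λ c p q c+p≡m c+q≡y → trans (extend-beyond I c p q (inj₁ (ℕₚ.≤-reflexive (cong suc (sym c+p≡m)))))
                                    (sym (≤ᵇ-false (s≤s (subst (c ≤_) c+q≡y (ℕₚ.m≤m+n c q)))))

  cornerIdeal-idealCorner : ∀ {I} → IsOrderIdeal n I → ∀ u → cornerIdeal (idealCorner I) u ≡ I u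
  cornerIdeal-idealCorner {I} isI ((c₁ , c₂ , c₃) , p) = begin
    falses (column I 0 (c₁ + c₂) (c₁ + c₃)) n ≤ᵇ c₁  ≡⟨ monotone-threshold (column-monotone isI 0 _ _) c₁<n ⟨
    column I 0 (c₁ + c₂) (c₁ + c₃) c₁               ≡⟨ column-diagonal I 0 c₁ c₂ c₃ ⟩
    extend I (c₁ , c₂ , c₃)                         ≡⟨ extend-≡ I c₁ c₂ c₃ p ⟩
    I ((c₁ , c₂ , c₃) , p)                          ∎
    where
    open ≡-Reasoning
    c₁<n : c₁ < n
    c₁<n = ℕₚ.≤-trans (s≤s (ℕₚ.m≤m+n c₁ c₂)) (ℕₚ.<⇒≤ (proj₁ (cells<n c₁ c₂ c₃ p)))

  module _ {h : ℕ → ℕ → ℕ} (isCornerSum : IsCornerSum n h) where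
    open IsCornerSum isCornerSum

    cornerIdeal-extend : ∀ x y → x < n → y < n → ∀ c p q → c + p ≡ x → c + q ≡ y →
                           extend (cornerIdeal h) (c , p , q) ≡ (h (suc x) (suc y) ≤ᵇ c)
    cornerIdeal-extend x y x<n y<n c p q refl refl with c + p + q + 2 ℕₚ.≤? n
    ... | yes w = refl
    ... | no ¬w = sym (≤ᵇ-false (ℕₚ.+-cancelʳ-≤ (c + p + q + 1) (suc c) r (begin
      suc c + (c + p + q + 1)       ≡⟨ rearrange c p q ⟩
      suc (c + p) + suc (c + q)     ≤⟨ +-bound (suc (c + p)) (suc (c + q)) x<n y<n ⟩
      r + n                         ≤⟨ ℕₚ.+-monoʳ-≤ r (ℕₚ.≤-pred (ℕₚ.≤-trans (ℕₚ.≰⇒> ¬w)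
                                         (ℕₚ.≤-reflexive (ℕₚ.+-suc (c + p + q) 1)))) ⟩
      r + (c + p + q + 1)           ∎)))
      where
      open ℕₚ.≤-Reasoning
      r : ℕ
      r = h (suc (c + p)) (suc (c + q))
      rearrange : ∀ c p q → suc c + (c + p + q + 1) ≡ suc (c + p) + suc (c + q)
      rearrange = ℕ-Solver.solve-∀

    idealCorner-cornerIdeal : ∀ i j → i ≤ n → j ≤ n → idealCorner (cornerIdeal h) i j ≡ h i j
    idealCorner-cornerIdeal zero    j       _   _   = sym (top j)
    idealCorner-cornerIdeal (suc x) zero    _   _   = sym (left (suc x))
    idealCorner-cornerIdeal (suc x) (suc y) x<n y<n =
      idealCorner-threshold (cornerIdeal h) x y _ (ℕₚ.≤-trans (≤-row _ _ x<n y<n) x<n)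
        (≤-row _ _ x<n y<n) (≤-col _ _ x<n y<n) (cornerIdeal-extend x y x<n y<n)

  -- Alternating sign matrices and corner-sum matrices

  rowDiff : (ℕ → ℕ → ℕ) → ℕ → ℕ → ℤ
  rowDiff h i j = + h (suc i) j - + h i j

  doubleDiff : (ℕ → ℕ → ℕ) → ℕ → ℕ → ℤ
  doubleDiff h i j = rowDiff h i (suc j) - rowDiff h i j

  diffMatrix : (ℕ → ℕ → ℕ) → Matrix n
  diffMatrix h i j = doubleDiff h (toℕ i) (toℕ j)

  doubleDiff-columnwise : ∀ h i j →
    doubleDiff h i j ≡ (+ h (suc i) (suc j) - + h (suc i) j) - (+ h i (suc j) - + h i j)
  doubleDiff-columnwise h i j = swap (+ h (suc i) (suc j)) (+ h i (suc j)) (+ h (suc i) j) (+ h i j)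
    where
    swap : ∀ a b c d → (a - b) - (c - d) ≡ (a - c) - (b - d)
    swap = solve-∀

  module _ {h : ℕ → ℕ → ℕ} (isCornerSum : IsCornerSum n h) where
    open IsCornerSum isCornerSum

    rowBit colBit : ℕ → ℕ → Bool
    rowBit i j = does (h i j ℕₚ.<? h (suc i) j)
    colBit j i = does (h i j ℕₚ.<? h i (suc j))

    doubleDiff-row-increments : ∀ i → i < n → Increments false (tabulateℕ n (doubleDiff h i))
    doubleDiff-row-increments i i<n = subst (λ b → Increments b (tabulateℕ n (doubleDiff h i))) start
      (states⇒increments n _ (rowBit i) (λ j j<n → cong₂ _-_
        (unitStep-diff (down i (suc j) i<n j<n)) (unitStep-diff (down i j i<n (ℕₚ.<⇒≤ j<n)))) end)
      where
      start : rowBit i 0 ≡ false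
      start rewrite left i | left (suc i) = refl
      end : rowBit i n ≡ true
      end rewrite right i (ℕₚ.<⇒≤ i<n) | right (suc i) i<n = dec-true (i ℕₚ.<? suc i) ℕₚ.≤-refl

    doubleDiff-column-increments : ∀ j → j < n → Increments false (tabulateℕ n (λ i → doubleDiff h i j))
    doubleDiff-column-increments j j<n = subst (λ b → Increments b (tabulateℕ n (λ i → doubleDiff h i j))) start
      (states⇒increments n _ (colBit j) (λ i i<n → trans (doubleDiff-columnwise h i j) (cong₂ _-_
        (unitStep-diff (across (suc i) j i<n j<n)) (unitStep-diff (across i j (ℕₚ.<⇒≤ i<n) j<n)))) end)
      where
      start : colBit j 0 ≡ false
      start rewrite top j | top (suc j) = refl
      end : colBit j n ≡ true
      end rewrite bottom j (ℕₚ.<⇒≤ j<n) | bottom (suc j) j<n = dec-true (j ℕₚ.<? suc j) ℕₚ.≤-refl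

    doubleDiff-entry : ∀ i j → i < n → j < n → Entry (doubleDiff h i j)
    doubleDiff-entry i j i<n j<n = subst Entry
      (sym (cong₂ _-_ (unitStep-diff (down i (suc j) i<n j<n)) (unitStep-diff (down i j i<n (ℕₚ.<⇒≤ j<n)))))
      (entry-val-diff (rowBit i j) (rowBit i (suc j)))

    diffMatrix-isASM : IsASM n (diffMatrix h)
    diffMatrix-isASM =
      (λ i j → doubleDiff-entry (toℕ i) (toℕ j) (Finₚ.toℕ<n i) (Finₚ.toℕ<n j)) ,
      (λ i → proj₁ (row-line i)) ,
      (λ j → proj₁ (column-line j)) ,
      (λ i → proj₂ (row-line i)) ,
      (λ j → proj₂ (column-line j))
      where
      row-line : ∀ i → sumℤ (row (diffMatrix h) i) ≡ 1ℤ × Alternates (nonzeros (row (diffMatrix h) i))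
      row-line i = increments⇒asmLine _ (doubleDiff-row-increments (toℕ i) (Finₚ.toℕ<n i))
      column-line : ∀ j → sumℤ (col (diffMatrix h) j) ≡ 1ℤ × Alternates (nonzeros (col (diffMatrix h) j))
      column-line j = increments⇒asmLine _ (doubleDiff-column-increments (toℕ j) (Finₚ.toℕ<n j))

  extendMatrix : Matrix n → ℕ → ℕ → ℤ
  extendMatrix A i j with i ℕₚ.<? n | j ℕₚ.<? n
  ... | yes i<n | yes j<n = A (fromℕ< i<n) (fromℕ< j<n)
  ... | yes _   | no  _   = 0ℤ
  ... | no  _   | _       = 0ℤ

  extendMatrix-fromℕ< : ∀ A {i j} (i<n : i < n) (j<n : j < n) → extendMatrix A i j ≡ A (fromℕ< i<n) (fromℕ< j<n)
  extendMatrix-fromℕ< A {i} {j} i<n j<n with i ℕₚ.<? n | j ℕₚ.<? n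
  ... | yes _ | yes _ = refl
  ... | yes _ | no ¬q = ⊥-elim (¬q j<n)
  ... | no ¬p | _     = ⊥-elim (¬p i<n)

  extendMatrix-row : ∀ A {i} (i<n : i < n) (j : Fin n) → extendMatrix A i (toℕ j) ≡ A (fromℕ< i<n) j
  extendMatrix-row A i<n j = trans (extendMatrix-fromℕ< A i<n (Finₚ.toℕ<n j)) (cong (A _) (Finₚ.fromℕ<-toℕ j _))

  extendMatrix-col : ∀ A {j} (j<n : j < n) (i : Fin n) → extendMatrix A (toℕ i) j ≡ A i (fromℕ< j<n)
  extendMatrix-col A j<n i =
    trans (extendMatrix-fromℕ< A (Finₚ.toℕ<n i) j<n) (cong (λ k → A k _) (Finₚ.fromℕ<-toℕ i _))

  extendMatrix-toℕ : ∀ A (i j : Fin n) → extendMatrix A (toℕ i) (toℕ j) ≡ A i j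
  extendMatrix-toℕ A i j = trans (extendMatrix-row A (Finₚ.toℕ<n i) j) (cong (λ k → A k j) (Finₚ.fromℕ<-toℕ i _))

  extendMatrix-cong : ∀ A B → (∀ i j → A i j ≡ B i j) → ∀ i j → extendMatrix A i j ≡ extendMatrix B i j
  extendMatrix-cong A B e i j with i ℕₚ.<? n | j ℕₚ.<? n
  ... | yes _ | yes _ = e _ _
  ... | yes _ | no  _ = refl
  ... | no  _ | _     = refl

  rowPartial colPartial : Matrix n → ℕ → ℕ → ℤ
  rowPartial A i = prefixSum (extendMatrix A i)
  colPartial A j = prefixSum (λ i → extendMatrix A i j)

  cornerSum : Matrix n → ℕ → ℕ → ℕ
  cornerSum A zero    j = 0
  cornerSum A (suc i) j = cornerSum A i j + ∣ rowPartial A i j ∣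

  cornerSum-cong : ∀ A B → (∀ i j → A i j ≡ B i j) → ∀ i j → cornerSum A i j ≡ cornerSum B i j
  cornerSum-cong A B e zero    j = refl
  cornerSum-cong A B e (suc i) j = cong₂ _+_ (cornerSum-cong A B e i j)
    (cong ∣_∣ (prefixSum-cong _ _ j (λ k _ → extendMatrix-cong A B e i k)))

  module _ {A : Matrix n} (isASM : IsASM n A) where
    private
      entries : ∀ i j → Entry (A i j)
      entries = proj₁ isASM
      row-sums : ∀ i → sumℤ (row A i) ≡ 1ℤ
      row-sums = proj₁ (proj₂ isASM)
      column-sums : ∀ j → sumℤ (col A j) ≡ 1ℤ
      column-sums = proj₁ (proj₂ (proj₂ isASM))
      row-alternates : ∀ i → Alternates (nonzeros (row A i))
      row-alternates = proj₁ (proj₂ (proj₂ (proj₂ isASM)))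
      column-alternates : ∀ j → Alternates (nonzeros (col A j))
      column-alternates = proj₂ (proj₂ (proj₂ (proj₂ isASM)))

    asm-row-increments : ∀ i → i < n → Increments false (tabulateℕ n (extendMatrix A i))
    asm-row-increments i i<n = subst (Increments false) (Listₚ.tabulate-cong (sym ∘ extendMatrix-row A i<n))
      (asmLine⇒increments _ (Allₚ.tabulate⁺ (entries (fromℕ< i<n))) (row-sums _) (row-alternates _))

    asm-column-increments : ∀ j → j < n → Increments false (tabulateℕ n (λ i → extendMatrix A i j))
    asm-column-increments j j<n = subst (Increments false) (Listₚ.tabulate-cong (sym ∘ extendMatrix-col A j<n))
      (asmLine⇒increments _ (Allₚ.tabulate⁺ (λ i → entries i (fromℕ< j<n)))
                            (column-sums _) (column-alternates _))

    rowPartial-bit : ∀ i j → i < n → j ≤ n →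
                     + ∣ rowPartial A i j ∣ ≡ rowPartial A i j × ∣ rowPartial A i j ∣ ≤ 1
    rowPartial-bit i j i<n j≤n = bit-abs (increments⇒prefixSum-bit n _ (asm-row-increments i i<n) j j≤n)

    colPartial-bit : ∀ j i → j < n → i ≤ n →
                     + ∣ colPartial A j i ∣ ≡ colPartial A j i × ∣ colPartial A j i ∣ ≤ 1
    colPartial-bit j i j<n i≤n = bit-abs (increments⇒prefixSum-bit n _ (asm-column-increments j j<n) i i≤n)

    cornerSum-prefixSum : ∀ i j → i ≤ n → j ≤ n → + cornerSum A i j ≡ prefixSum (λ i′ → rowPartial A i′ j) i
    cornerSum-prefixSum zero    j _   _   = refl
    cornerSum-prefixSum (suc i) j i<n j≤n = trans (ℤₚ.pos-+ (cornerSum A i j) _)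
      (cong₂ _+ℤ_ (cornerSum-prefixSum i j (ℕₚ.<⇒≤ i<n) j≤n) (proj₁ (rowPartial-bit i j i<n j≤n)))

    cornerSum-across : ∀ i j → i ≤ n → j < n → cornerSum A i (suc j) ≡ cornerSum A i j + ∣ colPartial A j i ∣
    cornerSum-across i j i≤n j<n = ℤₚ.+-injective (begin
      + cornerSum A i (suc j)
        ≡⟨ cornerSum-prefixSum i (suc j) i≤n j<n ⟩
      prefixSum (λ i′ → rowPartial A i′ j +ℤ extendMatrix A i′ j) i
        ≡⟨ prefixSum-+ _ _ i ⟩
      prefixSum (λ i′ → rowPartial A i′ j) i +ℤ colPartial A j i
        ≡⟨ cong₂ _+ℤ_ (cornerSum-prefixSum i j i≤n (ℕₚ.<⇒≤ j<n)) (proj₁ (colPartial-bit j i j<n i≤n)) ⟨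
      + cornerSum A i j +ℤ + ∣ colPartial A j i ∣
        ≡⟨ ℤₚ.pos-+ (cornerSum A i j) _ ⟨
      + (cornerSum A i j + ∣ colPartial A j i ∣) ∎)
      where open ≡-Reasoning

    cornerSum-isCornerSum : IsCornerSum n (cornerSum A)
    cornerSum-isCornerSum = record
      { top    = λ _ → refl
      ; left   = left
      ; right  = right
      ; bottom = bottom
      ; down   = λ i j i<n j≤n → unitStep-+ (cornerSum A i j) (proj₂ (rowPartial-bit i j i<n j≤n))
      ; across = λ i j i≤n j<n → subst (UnitStep (cornerSum A i j)) (sym (cornerSum-across i j i≤n j<n))
                                       (unitStep-+ (cornerSum A i j) (proj₂ (colPartial-bit j i j<n i≤n)))
      }
      where
      left : ∀ i → cornerSum A i 0 ≡ 0
      left zero    = refl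
      left (suc i) = trans (ℕₚ.+-identityʳ _) (left i)
      right : ∀ i → i ≤ n → cornerSum A i n ≡ i
      right zero    _   = refl
      right (suc i) i<n = trans (cong₂ _+_ (right i (ℕₚ.<⇒≤ i<n))
                                           (cong ∣_∣ (increments⇒total n _ (asm-row-increments i i<n))))
                                (ℕₚ.+-comm i 1)
      bottom : ∀ j → j ≤ n → cornerSum A n j ≡ j
      bottom zero    _   = left n
      bottom (suc j) j<n = trans (cornerSum-across n j ℕₚ.≤-refl j<n)
        (trans (cong₂ _+_ (bottom j (ℕₚ.<⇒≤ j<n))
                          (cong ∣_∣ (increments⇒total n _ (asm-column-increments j j<n))))
               (ℕₚ.+-comm j 1))

    rowDiff-cornerSum : ∀ i j → i < n → j ≤ n → rowDiff (cornerSum A) i j ≡ rowPartial A i j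
    rowDiff-cornerSum i j i<n j≤n = trans ([+n]-[+m]≡+[n∸m] (ℕₚ.m≤m+n (cornerSum A i j) _))
      (trans (cong +_ (ℕₚ.m+n∸m≡n (cornerSum A i j) _)) (proj₁ (rowPartial-bit i j i<n j≤n)))

    diffMatrix-cornerSum : ∀ i j → diffMatrix (cornerSum A) i j ≡ A i j
    diffMatrix-cornerSum i j = begin
      rowDiff (cornerSum A) a (suc b) - rowDiff (cornerSum A) a b
        ≡⟨ cong₂ _-_ (rowDiff-cornerSum a (suc b) a<n b<n) (rowDiff-cornerSum a b a<n (ℕₚ.<⇒≤ b<n)) ⟩
      (rowPartial A a b +ℤ extendMatrix A a b) - rowPartial A a b
        ≡⟨ cancel (rowPartial A a b) (extendMatrix A a b) ⟩
      extendMatrix A a b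
        ≡⟨ extendMatrix-toℕ A i j ⟩
      A i j ∎
      where
      open ≡-Reasoning
      a b : ℕ
      a = toℕ i
      b = toℕ j
      a<n : a < n
      a<n = Finₚ.toℕ<n i
      b<n : b < n
      b<n = Finₚ.toℕ<n j
      cancel : ∀ x y → (x +ℤ y) - x ≡ y
      cancel = solve-∀

  module _ {h : ℕ → ℕ → ℕ} (isCornerSum : IsCornerSum n h) where
    open IsCornerSum isCornerSum

    rowPartial-diffMatrix : ∀ i j → i < n → j ≤ n → rowPartial (diffMatrix h) i j ≡ rowDiff h i j
    rowPartial-diffMatrix i j i<n j≤n = begin
      prefixSum (extendMatrix (diffMatrix h) i) j  ≡⟨ prefixSum-cong _ _ j entries ⟩
      prefixSum (doubleDiff h i) j                 ≡⟨ prefixSum-telescope (rowDiff h i) j ⟩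
      rowDiff h i j - rowDiff h i 0                ≡⟨ cong (λ z → rowDiff h i j - z) rowDiff-left ⟩
      rowDiff h i j - 0ℤ                           ≡⟨ ℤₚ.+-identityʳ _ ⟩
      rowDiff h i j                                ∎
      where
      open ≡-Reasoning
      entries : ∀ k → k < j → extendMatrix (diffMatrix h) i k ≡ doubleDiff h i k
      entries k k<j = trans (extendMatrix-fromℕ< (diffMatrix h) i<n (ℕₚ.<-≤-trans k<j j≤n))
                            (cong₂ (doubleDiff h) (Finₚ.toℕ-fromℕ< i<n) (Finₚ.toℕ-fromℕ< _))
      rowDiff-left : rowDiff h i 0 ≡ 0ℤ
      rowDiff-left rewrite left i | left (suc i) = refl

    cornerSum-diffMatrix : ∀ i j → i ≤ n → j ≤ n → cornerSum (diffMatrix h) i j ≡ h i j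
    cornerSum-diffMatrix zero    j _   _   = sym (top j)
    cornerSum-diffMatrix (suc i) j i<n j≤n = begin
      cornerSum (diffMatrix h) i j + ∣ rowPartial (diffMatrix h) i j ∣
        ≡⟨ cong₂ _+_ (cornerSum-diffMatrix i j (ℕₚ.<⇒≤ i<n) j≤n) (cong ∣_∣ (rowPartial-diffMatrix i j i<n j≤n)) ⟩
      h i j + ∣ + h (suc i) j - + h i j ∣
        ≡⟨ cong (λ z → h i j + ∣ z ∣) ([+n]-[+m]≡+[n∸m] step) ⟩
      h i j + (h (suc i) j ∸ h i j)
        ≡⟨ ℕₚ.m+[n∸m]≡n step ⟩
      h (suc i) j ∎
      where
      open ≡-Reasoning
      step : h i j ≤ h (suc i) j
      step = proj₁ (down i j i<n j≤n)

  AgreeOnBox : (ℕ → ℕ → ℕ) → (ℕ → ℕ → ℕ) → Set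
  AgreeOnBox h h′ = ∀ i j → i ≤ n → j ≤ n → h i j ≡ h′ i j

  diffMatrix-cong : ∀ {h h′} → AgreeOnBox h h′ → ∀ i j → diffMatrix h i j ≡ diffMatrix h′ i j
  diffMatrix-cong {h} {h′} e i j = cong₂ _-_ (cong₂ _-_ (at a<n b<n) (at (ℕₚ.<⇒≤ a<n) b<n))
                                             (cong₂ _-_ (at a<n (ℕₚ.<⇒≤ b<n)) (at (ℕₚ.<⇒≤ a<n) (ℕₚ.<⇒≤ b<n)))
    where
    a<n : toℕ i < n
    a<n = Finₚ.toℕ<n i
    b<n : toℕ j < n
    b<n = Finₚ.toℕ<n j
    at : ∀ {x y} → x ≤ n → y ≤ n → + h x y ≡ + h′ x y
    at x≤n y≤n = cong +_ (e _ _ x≤n y≤n)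

  cornerIdeal-cong : ∀ {h h′} → AgreeOnBox h h′ → ∀ u → cornerIdeal h u ≡ cornerIdeal h′ u
  cornerIdeal-cong e ((a , b , c) , p) =
    cong (_≤ᵇ a) (e _ _ (ℕₚ.<⇒≤ (proj₁ (cells<n a b c p))) (ℕₚ.<⇒≤ (proj₂ (cells<n a b c p))))

  ideal⇒asm : J-T n → ASM n
  ideal⇒asm (I , isI) = diffMatrix (idealCorner I) , diffMatrix-isASM (idealCorner-isCornerSum isI)

  asm⇒ideal : ASM n → J-T n
  asm⇒ideal (A , isA) = cornerIdeal (cornerSum A) , cornerIdeal-isOrderIdeal (cornerSum-isCornerSum isA)

  open Setoid (J-T-Setoid n) using () renaming (_≈_ to _≈ᴶ_)
  open Setoid (ASM-Setoid n) using () renaming (_≈_ to _≈ᴬ_)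

  ideal⇒asm-cong : Congruent _≈ᴶ_ _≈ᴬ_ ideal⇒asm
  ideal⇒asm-cong e = diffMatrix-cong (λ i j _ _ → idealCorner-cong _ _ e i j)

  asm⇒ideal-cong : Congruent _≈ᴬ_ _≈ᴶ_ asm⇒ideal
  asm⇒ideal-cong e = cornerIdeal-cong (λ i j _ _ → cornerSum-cong _ _ e i j)

  ideal⇒asm∘asm⇒ideal : StrictlyInverseˡ _≈ᴬ_ ideal⇒asm asm⇒ideal
  ideal⇒asm∘asm⇒ideal (A , isA) i j =
    trans (diffMatrix-cong (idealCorner-cornerIdeal (cornerSum-isCornerSum isA)) i j) (diffMatrix-cornerSum isA i j)

  asm⇒ideal∘ideal⇒asm : StrictlyInverseʳ _≈ᴶ_ ideal⇒asm asm⇒ideal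
  asm⇒ideal∘ideal⇒asm (I , isI) u =
    trans (cornerIdeal-cong (cornerSum-diffMatrix (idealCorner-isCornerSum isI)) u) (cornerIdeal-idealCorner isI u)

  ideals↔asms : Inverse (J-T-Setoid n) (ASM-Setoid n)
  ideals↔asms = record
    { to        = ideal⇒asm
    ; from      = asm⇒ideal
    ; to-cong   = λ {I} {I′} → ideal⇒asm-cong {I} {I′}
    ; from-cong = λ {A} {B} → asm⇒ideal-cong {A} {B}
    ; inverse   = (λ {A} {I} I≈ i j →
                    trans (ideal⇒asm-cong {I} {asm⇒ideal A} I≈ i j) (ideal⇒asm∘asm⇒ideal A i j)) ,
                  (λ {I} {A} A≈ u →
                    trans (asm⇒ideal-cong {A} {ideal⇒asm I} A≈ u) (asm⇒ideal∘ideal⇒asm I u))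
    }

proposition5p2 : ∀ (n : ℕ) → 1 ≤ n → Bijection (J-T-Setoid n) (ASM-Setoid n)
proposition5p2 n _ = Inverse⇒Bijection (Correspondence.ideals↔asms n)
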